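{- Let $(G,\rho)$ be a reduced maximal Gallai multigraph. The vertices connected by two edges form uniformly colored cliques: that is, if $u,v,w$ are distinct vertices with $|\rho[uv]|=|\rho[vw]|=2$, then $\rho[uw]=\rho[uv]=\rho[vw]$ (in particular $|\rho[uw]|=2$).
   Context: An edge-colored (complete, loopless) multigraph $(G,\rho)$ has a finite vertex set $\mathcal V\subseteq\mathbb N$ and assigns to each unordered pair of distinct vertices $u,v$ a nonempty finite set $\rho[uv]$ of colors (the colors of the parallel edges joining $u$ and $v$; parallel edges have distinct colors). Three distinct vertices $u,v,w$ form a rainbow triangle if there are pairwise distinct colors $X\in\rho[uv]$, $Y\in\rho[vw]$, $Z\in\rho[uw]$. $(G,\rho)$ is a Gallai multigraph if it has no rainbow triangle; it is maximal if for every pair $u,v$ and every color $B\notin\rho[uv]$, adding $B$ to $\rho[uv]$ would create a rainbow triangle. A pair $u,v$ is isolated if $\rho[uw]=\rho[vw]$ and $|\rho[uw]|=1$ for every vertex $w\notin\{u,v\}$; $G$ is reduced if no pair is isolated. -}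

module Defs where

open import Data.Nat using (ℕ; _≟_)
open import Data.List using (List; []; _∷_; length)
open import Data.List.Membership.Propositional using (_∈_; _∉_)
open import Data.List.Relation.Unary.Unique.Propositional using (Unique)
open import Data.Product using (_×_; Σ; ∃; ∃-syntax; _,_)
open import Data.Bool using (Bool; true; false; _∨_; _∧_; if_then_else_)
open import Relation.Nullary using (¬_)
open import Relation.Nullary.Decidable using (⌊_⌋)
open import Relation.Binary.PropositionalEquality using (_≡_; _≢_)

-- Vertices and colours are natural numbers.  A colour set is a finite list
-- of colours without repetitions; colour sets are compared extensionally.
ColourSet : Set
ColourSet = List ℕ

_≈c_ : ColourSet → ColourSet → Set
A ≈c B = ∀ c → (c ∈ A → c ∈ B) × (c ∈ B → c ∈ A)

-- An edge-colouring: ρ u v is the set of colours of the parallel edges uv.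
Colouring : Set
Colouring = ℕ → ℕ → ColourSet

-- An edge-coloured complete loopless multigraph (G, ρ).
record EdgeColouredMultigraph : Set where
  field
    V          : List ℕ
    V-unique   : Unique V
    ρ          : Colouring
    ρ-unique   : ∀ u v → Unique (ρ u v)      -- parallel edges have distinct colours
    ρ-sym      : ∀ u v → ρ u v ≈c ρ v u
    ρ-nonempty : ∀ u v → u ∈ V → v ∈ V → u ≢ v → ρ u v ≢ []

RainbowTriangle : List ℕ → Colouring → ℕ → ℕ → ℕ → Set
RainbowTriangle V ρ u v w =
  u ∈ V × v ∈ V × w ∈ V × u ≢ v × v ≢ w × u ≢ w ×
  ∃[ X ] ∃[ Y ] ∃[ Z ]
    (X ∈ ρ u v × Y ∈ ρ v w × Z ∈ ρ u w × X ≢ Y × Y ≢ Z × X ≢ Z)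

HasRainbowTriangle : List ℕ → Colouring → Set
HasRainbowTriangle V ρ = ∃[ u ] ∃[ v ] ∃[ w ] RainbowTriangle V ρ u v w

addColour : Colouring → ℕ → ℕ → ℕ → Colouring
addColour ρ u v B x y =
  if (⌊ x ≟ u ⌋ ∧ ⌊ y ≟ v ⌋) ∨ (⌊ x ≟ v ⌋ ∧ ⌊ y ≟ u ⌋)
  then B ∷ ρ x y
  else ρ x y

module _ (G : EdgeColouredMultigraph) where
  open EdgeColouredMultigraph G

  IsGallai : Set
  IsGallai = ¬ HasRainbowTriangle V ρ

  IsMaximalGallai : Set
  IsMaximalGallai =
    IsGallai ×
    (∀ u v B → u ∈ V → v ∈ V → u ≢ v → B ∉ ρ u v →
       HasRainbowTriangle V (addColour ρ u v B))

  IsolatedPair : ℕ → ℕ → Set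
  IsolatedPair u v =
    ∀ w → w ∈ V → w ≢ u → w ≢ v → (ρ u w ≈c ρ v w) × length (ρ u w) ≡ 1

  IsReduced : Set
  IsReduced = ∀ u v → u ∈ V → v ∈ V → u ≢ v → ¬ IsolatedPair u v

module Submission where

-- Let u, v, w be distinct with ρ[uv] = {A, B} (A ≠ B) and |ρ[vw]| = 2.  Since no
-- triangle is rainbow, the colours X, Y, Z of any triangle repeat.  Two distinct
-- colours on one side then pin down the other sides:
--   * every colour of ρ[uw] is A or B (using both colours of ρ[vw]);
--   * hence every colour of ρ[vw] is A or B, and as it has two colours, ρ[vw] = {A, B};
--   * A ∈ ρ[uw] (and symmetrically B): otherwise maximality lets us add A to uw,
--     creating a rainbow triangle, which must use the new edge, i.e. some vertex x
--     with colours A, Y ∈ ρ[wx], Z ∈ ρ[ux] pairwise distinct.  For x = v this is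
--     impossible as ρ[uv] = ρ[vw] = {A, B}; otherwise any T ∈ ρ[vx] is forced to be
--     A by the triangles uvx, vwx, and then B = Z and B = Y, contradicting Y ≠ Z.

open import Defs
open import Data.Nat using (ℕ; _≟_)
open import Data.List using ([]; _∷_; length)
open import Data.List.Membership.Propositional using (_∈_)
open import Data.List.Membership.DecPropositional _≟_ using (_∈?_)
open import Data.List.Relation.Unary.Any using (here; there)
open import Data.List.Relation.Unary.AllPairs using (_∷_)
open import Data.List.Relation.Unary.All using ([]; _∷_)
open import Data.List.Relation.Unary.Unique.Propositional using (Unique)
open import Data.Product using (_×_; _,_; proj₁; proj₂; ∃-syntax)
open import Data.Sum using (_⊎_; inj₁; inj₂; swap)
open import Data.Empty using (⊥; ⊥-elim)
open import Function using (_∘_)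
open import Relation.Nullary using (¬_; yes; no)
open import Relation.Binary.PropositionalEquality using (_≡_; _≢_; refl; sym; trans)

Repeats : ℕ → ℕ → ℕ → Set
Repeats X Y Z = X ≡ Y ⊎ Y ≡ Z ⊎ X ≡ Z

repeats-swap : ∀ {X Y Z} → Repeats X Y Z → Repeats X Z Y
repeats-swap (inj₁ X≡Y)        = inj₂ (inj₂ X≡Y)
repeats-swap (inj₂ (inj₁ Y≡Z)) = inj₂ (inj₁ (sym Y≡Z))
repeats-swap (inj₂ (inj₂ X≡Z)) = inj₁ X≡Z

repeats⇒≡₁₃ : ∀ {X Y Z} → Repeats X Y Z → X ≢ Y → Y ≢ Z → X ≡ Z
repeats⇒≡₁₃ (inj₁ X≡Y)        X≢Y _   = ⊥-elim (X≢Y X≡Y)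
repeats⇒≡₁₃ (inj₂ (inj₁ Y≡Z)) _   Y≢Z = ⊥-elim (Y≢Z Y≡Z)
repeats⇒≡₁₃ (inj₂ (inj₂ X≡Z)) _   _   = X≡Z

repeats⇒≡₁₂ : ∀ {X Y Z} → Repeats X Y Z → Y ≢ Z → X ≢ Z → X ≡ Y
repeats⇒≡₁₂ (inj₁ X≡Y)        _   _   = X≡Y
repeats⇒≡₁₂ (inj₂ (inj₁ Y≡Z)) Y≢Z _   = ⊥-elim (Y≢Z Y≡Z)
repeats⇒≡₁₂ (inj₂ (inj₂ X≡Z)) _   X≢Z = ⊥-elim (X≢Z X≡Z)

repeats-pair : ∀ {A B S T} → A ≢ B → Repeats A S T → Repeats B S T →
  S ≡ A ⊎ S ≡ B ⊎ S ≡ T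
repeats-pair _   (inj₁ A≡S)        _                 = inj₁ (sym A≡S)
repeats-pair _   (inj₂ (inj₁ S≡T)) _                 = inj₂ (inj₂ S≡T)
repeats-pair _   _                 (inj₁ B≡S)        = inj₂ (inj₁ (sym B≡S))
repeats-pair _   _                 (inj₂ (inj₁ S≡T)) = inj₂ (inj₂ S≡T)
repeats-pair A≢B (inj₂ (inj₂ A≡T)) (inj₂ (inj₂ B≡T)) = ⊥-elim (A≢B (trans A≡T (sym B≡T)))

among-pair : ∀ {A B C D Z : ℕ} → C ≢ D →
  Z ≡ A ⊎ Z ≡ B ⊎ Z ≡ C → Z ≡ A ⊎ Z ≡ B ⊎ Z ≡ D → Z ≡ A ⊎ Z ≡ B
among-pair _   (inj₁ Z≡A)        _                 = inj₁ Z≡A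
among-pair _   (inj₂ (inj₁ Z≡B)) _                 = inj₂ Z≡B
among-pair _   _                 (inj₁ Z≡A)        = inj₁ Z≡A
among-pair _   _                 (inj₂ (inj₁ Z≡B)) = inj₂ Z≡B
among-pair C≢D (inj₂ (inj₂ Z≡C)) (inj₂ (inj₂ Z≡D)) = ⊥-elim (C≢D (trans (sym Z≡C) Z≡D))

one-of-pair : ∀ {A B S T : ℕ} → S ≡ A ⊎ S ≡ B ⊎ S ≡ T → T ≡ A ⊎ T ≡ B → S ≡ A ⊎ S ≡ B
one-of-pair (inj₁ S≡A)         _    = inj₁ S≡A
one-of-pair (inj₂ (inj₁ S≡B))  _    = inj₂ S≡B
one-of-pair (inj₂ (inj₂ refl)) T∈AB = T∈AB

apex-colour : ∀ {K T Y Z} → K ≢ Y → K ≢ Z → Y ≢ Z → Repeats K T Z → Repeats K Y T → T ≡ K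
apex-colour _   _   _   (inj₁ K≡T)        _                 = sym K≡T
apex-colour _   K≢Z _   (inj₂ (inj₂ K≡Z)) _                 = ⊥-elim (K≢Z K≡Z)
apex-colour K≢Y _   _   _                 (inj₁ K≡Y)        = ⊥-elim (K≢Y K≡Y)
apex-colour _   _   _   _                 (inj₂ (inj₂ K≡T)) = sym K≡T
apex-colour _   _   Y≢Z (inj₂ (inj₁ T≡Z)) (inj₂ (inj₁ Y≡T)) = ⊥-elim (Y≢Z (trans Y≡T T≡Z))

≈c-sym : ∀ {L M : ColourSet} → L ≈c M → M ≈c L
≈c-sym L≈M c = proj₂ (L≈M c) , proj₁ (L≈M c)

≈c-trans : ∀ {L M N : ColourSet} → L ≈c M → M ≈c N → L ≈c N
≈c-trans L≈M M≈N c =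
  (λ c∈L → proj₁ (M≈N c) (proj₁ (L≈M c) c∈L)) , (λ c∈N → proj₂ (L≈M c) (proj₂ (M≈N c) c∈N))

∈-pair⁻ : ∀ {A B c : ℕ} → c ∈ A ∷ B ∷ [] → c ≡ A ⊎ c ≡ B
∈-pair⁻ (here c≡A)         = inj₁ c≡A
∈-pair⁻ (there (here c≡B)) = inj₂ c≡B
∈-pair⁻ (there (there ()))

∈-pair⁺ : ∀ {A B c : ℕ} → c ≡ A ⊎ c ≡ B → c ∈ A ∷ B ∷ []
∈-pair⁺ (inj₁ c≡A) = here c≡A
∈-pair⁺ (inj₂ c≡B) = there (here c≡B)

pair-comm : ∀ {A B : ℕ} → (A ∷ B ∷ []) ≈c (B ∷ A ∷ [])
pair-comm c = (λ c∈ → ∈-pair⁺ (swap (∈-pair⁻ c∈))) , (λ c∈ → ∈-pair⁺ (swap (∈-pair⁻ c∈)))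

module _ {L : ColourSet} {A B : ℕ} (L≈AB : L ≈c (A ∷ B ∷ [])) where

  pair-fst : A ∈ L
  pair-fst = proj₂ (L≈AB A) (here refl)

  pair-snd : B ∈ L
  pair-snd = proj₂ (L≈AB B) (there (here refl))

  pair-within : ∀ {c} → c ∈ L → c ≡ A ⊎ c ≡ B
  pair-within {c} c∈L = ∈-pair⁻ (proj₁ (L≈AB c) c∈L)

within⇒≈c : ∀ {L : ColourSet} {A B : ℕ} → (∀ {c} → c ∈ L → c ≡ A ⊎ c ≡ B) →
  A ∈ L → B ∈ L → L ≈c (A ∷ B ∷ [])
within⇒≈c {L} {A} {B} L⊆AB A∈L B∈L c =
  (λ c∈L → ∈-pair⁺ (L⊆AB c∈L)) , (λ c∈AB → AB⊆L (∈-pair⁻ c∈AB))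
  where
  AB⊆L : c ≡ A ⊎ c ≡ B → c ∈ L
  AB⊆L (inj₁ refl) = A∈L
  AB⊆L (inj₂ refl) = B∈L

covers : ∀ {L : ColourSet} {A B C D : ℕ} → C ≡ A ⊎ C ≡ B → D ≡ A ⊎ D ≡ B → C ≢ D →
  C ∈ L → D ∈ L → A ∈ L
covers (inj₁ refl) _           _   C∈L _   = C∈L
covers (inj₂ refl) (inj₁ refl) _   _   D∈L = D∈L
covers (inj₂ refl) (inj₂ refl) C≢D _   _   = ⊥-elim (C≢D refl)

length≡2⇒pair : ∀ {L : ColourSet} → Unique L → length L ≡ 2 →
  ∃[ A ] ∃[ B ] A ≢ B × L ≈c (A ∷ B ∷ [])
length≡2⇒pair {A ∷ B ∷ []} ((A≢B ∷ []) ∷ _) refl = A , B , A≢B , λ _ → (λ c∈ → c∈) , (λ c∈ → c∈)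

nonempty⇒member : ∀ (L : ColourSet) → L ≢ [] → ∃[ c ] c ∈ L
nonempty⇒member []      L≢[] = ⊥-elim (L≢[] refl)
nonempty⇒member (c ∷ _) _    = c , here refl

∈-∷⁻ : ∀ {c K : ℕ} {L : ColourSet} {P : Set} → c ∈ K ∷ L → P → c ∈ L ⊎ (c ≡ K × P)
∈-∷⁻ (here c≡K) p = inj₂ (c≡K , p)
∈-∷⁻ (there c∈L) _ = inj₁ c∈L

∈-addColour : ∀ ρ u w K x y c → c ∈ addColour ρ u w K x y →
  c ∈ ρ x y ⊎ (c ≡ K × ((x ≡ u × y ≡ w) ⊎ (x ≡ w × y ≡ u)))
∈-addColour ρ u w K x y c c∈ with x ≟ u | y ≟ w | x ≟ w | y ≟ u
... | yes x≡u | yes y≡w | _       | _       = ∈-∷⁻ c∈ (inj₁ (x≡u , y≡w))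
... | yes _   | no _    | yes x≡w | yes y≡u = ∈-∷⁻ c∈ (inj₂ (x≡w , y≡u))
... | yes _   | no _    | yes _   | no _    = inj₁ c∈
... | yes _   | no _    | no _    | _       = inj₁ c∈
... | no _    | _       | yes x≡w | yes y≡u = ∈-∷⁻ c∈ (inj₂ (x≡w , y≡u))
... | no _    | _       | yes _   | no _    = inj₁ c∈
... | no _    | _       | no _    | _       = inj₁ c∈

module Gallai (G : EdgeColouredMultigraph) (gallai : IsGallai G) where
  open EdgeColouredMultigraph G

  ∈-sym : ∀ {a b c} → c ∈ ρ a b → c ∈ ρ b a
  ∈-sym {a} {b} {c} = proj₁ (ρ-sym a b c)

  triangle-repeats : ∀ {a b c X Y Z} → a ∈ V → b ∈ V → c ∈ V →
    a ≢ b → b ≢ c → a ≢ c → X ∈ ρ a b → Y ∈ ρ b c → Z ∈ ρ a c → Repeats X Y Z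
  triangle-repeats {a} {b} {c} {X} {Y} {Z} a∈ b∈ c∈ a≢b b≢c a≢c X∈ Y∈ Z∈
    with X ≟ Y | Y ≟ Z | X ≟ Z
  ... | yes X≡Y | _       | _       = inj₁ X≡Y
  ... | no _    | yes Y≡Z | _       = inj₂ (inj₁ Y≡Z)
  ... | no _    | no _    | yes X≡Z = inj₂ (inj₂ X≡Z)
  ... | no X≢Y  | no Y≢Z  | no X≢Z  =
    ⊥-elim (gallai (a , b , c , a∈ , b∈ , c∈ , a≢b , b≢c , a≢c ,
                    X , Y , Z , X∈ , Y∈ , Z∈ , X≢Y , Y≢Z , X≢Z))

  NoRainbowApex : ℕ → ℕ → ℕ → Set
  NoRainbowApex u w K = ∀ {x Y Z} → x ∈ V → x ≢ u → x ≢ w →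
    Y ∈ ρ w x → Z ∈ ρ u x → K ≢ Y → K ≢ Z → Y ≢ Z → ⊥

  -- A rainbow triangle after adding K to uw must use the new edge, so adding K is
  -- harmless when no vertex is a rainbow apex for (u, w, K).
  addColour-Gallai : ∀ {u w K} → NoRainbowApex u w K →
    ¬ HasRainbowTriangle V (addColour ρ u w K)
  addColour-Gallai {u} {w} {K} noApex
    (a , b , c , a∈ , b∈ , c∈ , a≢b , b≢c , a≢c , X , Y , Z , X∈ , Y∈ , Z∈ , X≢Y , Y≢Z , X≢Z)
    with ∈-addColour ρ u w K a b X X∈ | ∈-addColour ρ u w K b c Y Y∈
       | ∈-addColour ρ u w K a c Z Z∈
  ... | inj₁ X∈ab | inj₁ Y∈bc | inj₁ Z∈ac =
    gallai (a , b , c , a∈ , b∈ , c∈ , a≢b , b≢c , a≢c ,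
            X , Y , Z , X∈ab , Y∈bc , Z∈ac , X≢Y , Y≢Z , X≢Z)
  ... | inj₂ (refl , _) | inj₂ (refl , _) | _               = X≢Y refl
  ... | inj₂ (refl , _) | _               | inj₂ (refl , _) = X≢Z refl
  ... | _               | inj₂ (refl , _) | inj₂ (refl , _) = Y≢Z refl
  ... | inj₂ (refl , inj₁ (refl , refl)) | inj₁ Y∈bc | inj₁ Z∈ac =
    noApex c∈ (a≢c ∘ sym) (b≢c ∘ sym) Y∈bc Z∈ac X≢Y X≢Z Y≢Z
  ... | inj₂ (refl , inj₂ (refl , refl)) | inj₁ Y∈bc | inj₁ Z∈ac =
    noApex c∈ (b≢c ∘ sym) (a≢c ∘ sym) Z∈ac Y∈bc X≢Z X≢Y (Y≢Z ∘ sym)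
  ... | inj₁ X∈ab | inj₂ (refl , inj₁ (refl , refl)) | inj₁ Z∈ac =
    noApex a∈ a≢b a≢c (∈-sym Z∈ac) (∈-sym X∈ab) Y≢Z (X≢Y ∘ sym) (X≢Z ∘ sym)
  ... | inj₁ X∈ab | inj₂ (refl , inj₂ (refl , refl)) | inj₁ Z∈ac =
    noApex a∈ a≢c a≢b (∈-sym X∈ab) (∈-sym Z∈ac) (X≢Y ∘ sym) Y≢Z X≢Z
  ... | inj₁ X∈ab | inj₁ Y∈bc | inj₂ (refl , inj₁ (refl , refl)) =
    noApex b∈ (a≢b ∘ sym) b≢c (∈-sym Y∈bc) X∈ab (Y≢Z ∘ sym) (X≢Z ∘ sym) (X≢Y ∘ sym)
  ... | inj₁ X∈ab | inj₁ Y∈bc | inj₂ (refl , inj₂ (refl , refl)) =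
    noApex b∈ b≢c (a≢b ∘ sym) X∈ab (∈-sym Y∈bc) (X≢Z ∘ sym) (Y≢Z ∘ sym) X≢Y

  colour-forced : IsMaximalGallai G → ∀ {u w K} → u ∈ V → w ∈ V → u ≢ w →
    NoRainbowApex u w K → K ∈ ρ u w
  colour-forced (_ , maximal) {u} {w} {K} u∈ w∈ u≢w noApex with K ∈? ρ u w
  ... | yes K∈uw = K∈uw
  ... | no K∉uw  = ⊥-elim (addColour-Gallai noApex (maximal u w K u∈ w∈ u≢w K∉uw))

  module Triangle {u v w} (u∈ : u ∈ V) (v∈ : v ∈ V) (w∈ : w ∈ V)
                  (u≢v : u ≢ v) (v≢w : v ≢ w) (u≢w : u ≢ w) where

    uvw-repeats : ∀ {X Y Z} → X ∈ ρ u v → Y ∈ ρ v w → Z ∈ ρ u w → Repeats X Y Z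
    uvw-repeats = triangle-repeats u∈ v∈ w∈ u≢v v≢w u≢w

    third-side-within : ∀ {A B C D Z} → A ≢ B → A ∈ ρ u v → B ∈ ρ u v →
      C ≢ D → C ∈ ρ v w → D ∈ ρ v w → Z ∈ ρ u w → Z ≡ A ⊎ Z ≡ B
    third-side-within A≢B A∈ B∈ C≢D C∈ D∈ Z∈ =
      among-pair C≢D
        (repeats-pair A≢B (repeats-swap (uvw-repeats A∈ C∈ Z∈)) (repeats-swap (uvw-repeats B∈ C∈ Z∈)))
        (repeats-pair A≢B (repeats-swap (uvw-repeats A∈ D∈ Z∈)) (repeats-swap (uvw-repeats B∈ D∈ Z∈)))

    second-side-within : ∀ {A B Y Z} → A ≢ B → A ∈ ρ u v → B ∈ ρ u v →
      Z ∈ ρ u w → Z ≡ A ⊎ Z ≡ B → Y ∈ ρ v w → Y ≡ A ⊎ Y ≡ B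
    second-side-within A≢B A∈ B∈ Z∈ Z∈AB Y∈ =
      one-of-pair (repeats-pair A≢B (uvw-repeats A∈ Y∈ Z∈) (uvw-repeats B∈ Y∈ Z∈)) Z∈AB

    second-side-pair : ∀ {A B C D} → A ≢ B → ρ u v ≈c (A ∷ B ∷ []) →
      C ≢ D → C ∈ ρ v w → D ∈ ρ v w → ρ v w ≈c (A ∷ B ∷ [])
    second-side-pair {A} {B} {C} {D} A≢B uv≈AB C≢D C∈ D∈
      with nonempty⇒member (ρ u w) (ρ-nonempty u w u∈ w∈ u≢w)
    ... | Z , Z∈ = within⇒≈c vw⊆AB (covers C∈AB D∈AB C≢D C∈ D∈)
                                   (covers (swap C∈AB) (swap D∈AB) C≢D C∈ D∈)
      where
      A∈ : A ∈ ρ u v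
      A∈ = pair-fst uv≈AB
      B∈ : B ∈ ρ u v
      B∈ = pair-snd uv≈AB
      vw⊆AB : ∀ {Y} → Y ∈ ρ v w → Y ≡ A ⊎ Y ≡ B
      vw⊆AB = second-side-within A≢B A∈ B∈ Z∈ (third-side-within A≢B A∈ B∈ C≢D C∈ D∈ Z∈)
      C∈AB : C ≡ A ⊎ C ≡ B
      C∈AB = vw⊆AB C∈
      D∈AB : D ≡ A ⊎ D ≡ B
      D∈AB = vw⊆AB D∈

    no-apex : ∀ {K K'} → K ≢ K' → ρ u v ≈c (K ∷ K' ∷ []) → ρ v w ≈c (K ∷ K' ∷ []) →
      NoRainbowApex u w K
    no-apex {K} {K'} K≢K' uv≈ vw≈ {x} {Y} {Z} x∈ x≢u x≢w Y∈wx Z∈ux K≢Y K≢Z Y≢Z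
      with x ≟ v
    ... | yes refl = both-K' (pair-within vw≈ (∈-sym Y∈wx)) (pair-within uv≈ Z∈ux)
      where
      both-K' : Y ≡ K ⊎ Y ≡ K' → Z ≡ K ⊎ Z ≡ K' → ⊥
      both-K' (inj₁ Y≡K) _ = K≢Y (sym Y≡K)
      both-K' _ (inj₁ Z≡K) = K≢Z (sym Z≡K)
      both-K' (inj₂ Y≡K') (inj₂ Z≡K') = Y≢Z (trans Y≡K' (sym Z≡K'))
    ... | no x≢v with nonempty⇒member (ρ v x) (ρ-nonempty v x v∈ x∈ (x≢v ∘ sym))
    ... | T , T∈vx = Y≢Z (trans (sym K'≡Y) K'≡Z)
      where
      uvx : ∀ {X} → X ∈ ρ u v → Repeats X T Z
      uvx X∈ = triangle-repeats u∈ v∈ x∈ u≢v (x≢v ∘ sym) (x≢u ∘ sym) X∈ T∈vx Z∈ux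
      vwx : ∀ {X} → X ∈ ρ v w → Repeats X Y T
      vwx X∈ = triangle-repeats v∈ w∈ x∈ v≢w (x≢w ∘ sym) (x≢v ∘ sym) X∈ Y∈wx T∈vx
      T≡K : T ≡ K
      T≡K = apex-colour K≢Y K≢Z Y≢Z (uvx (pair-fst uv≈)) (vwx (pair-fst vw≈))
      K'≢T : K' ≢ T
      K'≢T K'≡T = K≢K' (trans (sym T≡K) (sym K'≡T))
      K'≡Z : K' ≡ Z
      K'≡Z = repeats⇒≡₁₃ (uvx (pair-snd uv≈)) K'≢T (λ T≡Z → K≢Z (trans (sym T≡K) T≡Z))
      K'≡Y : K' ≡ Y
      K'≡Y = repeats⇒≡₁₂ (vwx (pair-snd vw≈)) (λ Y≡T → K≢Y (sym (trans Y≡T T≡K))) K'≢T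

theorem2p2 : (G : EdgeColouredMultigraph) →
    IsMaximalGallai G → IsReduced G →
    let open EdgeColouredMultigraph G in
    ∀ u v w → u ∈ V → v ∈ V → w ∈ V → u ≢ v → v ≢ w → u ≢ w →
    length (ρ u v) ≡ 2 → length (ρ v w) ≡ 2 →
    (ρ u w ≈c ρ u v) × (ρ u v ≈c ρ v w)
theorem2p2 G maximal _ u v w u∈ v∈ w∈ u≢v v≢w u≢w |uv|≡2 |vw|≡2 =
  let open EdgeColouredMultigraph G
      open Gallai G (proj₁ maximal)
      open Triangle u∈ v∈ w∈ u≢v v≢w u≢w
      (A , B , A≢B , uv≈AB) = length≡2⇒pair (ρ-unique u v) |uv|≡2
      (C , D , C≢D , vw≈CD) = length≡2⇒pair (ρ-unique v w) |vw|≡2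
      vw≈AB = second-side-pair A≢B uv≈AB C≢D (pair-fst vw≈CD) (pair-snd vw≈CD)
      uw⊆AB = λ {Z} → third-side-within {Z = Z} A≢B (pair-fst uv≈AB) (pair-snd uv≈AB)
                                                C≢D (pair-fst vw≈CD) (pair-snd vw≈CD)
      A∈uw = colour-forced maximal u∈ w∈ u≢w (no-apex A≢B uv≈AB vw≈AB)
      B∈uw = colour-forced maximal u∈ w∈ u≢w
               (no-apex (A≢B ∘ sym) (≈c-trans uv≈AB pair-comm) (≈c-trans vw≈AB pair-comm))
      uw≈AB = within⇒≈c uw⊆AB A∈uw B∈uw
  in ≈c-trans uw≈AB (≈c-sym uv≈AB) , ≈c-trans uv≈AB (≈c-sym vw≈AB)
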